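{- Let $r \ge 2$, $k \ge 1$, and $n \ge k$ be integers and let $\mathbf{s} = (s_1, \dots, s_n)$ be a vector of integers with $s_i \in [r-1]$. Let $N= \sum_i s_i$ and let $\mathcal{P} = \{P_1, \dots, P_n\}$ be a partition of $[N]$ with $|P_i| = s_i$. Then $\chi(\mathrm{KG}^r_{\mathbf{s}}(n,k)) \ge \chi(\mathrm{KG}^r(N, k; \mathcal{P}))$.
   Context: An $r$-uniform hypergraph on a vertex set $X$ is a set of hyperedges, each an $r$-element multisubset of $X$ (repetitions allowed). An $m$-coloring is a map $c\colon X\to[m]$ such that every hyperedge contains two vertices of different colors; $\chi(H)$ is the least $m$ for which an $m$-coloring exists. $\mathrm{KG}^r_{\mathbf{s}}(n,k)$ is the hypergraph on vertex set $\binom{[n]}{k}$ (the $k$-element subsets of $[n]$) in which a multisubset $\{\{A_1,\dots,A_r\}\}$ is a hyperedge iff each $i\in[n]$ is contained in at most $s_i$ of the sets $A_1,\dots,A_r$ (counted with multiplicity). For a partition $\mathcal{P}=\{P_1,\dots,P_\ell\}$ of $[N]$, $\mathrm{KG}^r(N,k;\mathcal{P})$ is the hypergraph whose vertices are the $k$-subsets $\sigma\subseteq[N]$ with $|\sigma\cap P_i|\le1$ for all $i$, and whose hyperedges are collections of $r$ such sets that are pairwise disjoint. -}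

module Defs where

open import Data.Nat using (ℕ; _≤_; _<_)
open import Data.Fin using (Fin)
open import Data.Fin.Subset using (Subset; ∣_∣; _∩_; _∈_)
open import Data.Vec using (tabulate; lookup)
open import Data.Vec.Functional as VF using ()
open import Data.Product using (Σ; ∃; ∃₂; _×_; proj₁)
open import Relation.Binary.PropositionalEquality using (_≡_; _≢_)
open import Relation.Nullary using (¬_; does)
open import Data.Fin using (_≟_)

-- A hyperedge (an r-element multiset) is represented by any
-- ordering of it, i.e. a map Fin r → V; all predicates used are
-- invariant under reordering.
record Hypergraph (r : ℕ) : Set₁ where
  field
    V    : Set
    Edge : (Fin r → V) → Set
open Hypergraph public

IsColoring : ∀ {r} (H : Hypergraph r) (m : ℕ) → (V H → Fin m) → Set
IsColoring H m c = ∀ e → Edge H e → ∃₂ λ i j → c (e i) ≢ c (e j)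

Colorable : ∀ {r} → Hypergraph r → ℕ → Set
Colorable H m = Σ (V H → Fin m) (IsColoring H m)

IsChromaticNumber : ∀ {r} → Hypergraph r → ℕ → Set
IsChromaticNumber H m = Colorable H m × (∀ m′ → m′ < m → ¬ Colorable H m′)

KSubset : ℕ → ℕ → Set
KSubset n k = Σ (Subset n) (λ A → ∣ A ∣ ≡ k)

mult : ∀ {n k r} → (Fin r → KSubset n k) → Fin n → ℕ
mult e i = ∣ tabulate (λ j → lookup (proj₁ (e j)) i) ∣

KGs : (r : ℕ) (n k : ℕ) (s : Fin n → ℕ) → Hypergraph r
KGs r n k s = record
  { V    = KSubset n k
  ; Edge = λ e → ∀ i → mult e i ≤ s i }

-- A partition of [N] into n blocks P_0..P_{n-1}, given by the block map p;
-- block p i = P_i = { x | p x = i }.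
block : ∀ {N n} → (Fin N → Fin n) → Fin n → Subset N
block p i = tabulate (λ x → does (p x ≟ i))

Disjoint : ∀ {N} → Subset N → Subset N → Set
Disjoint A B = ∀ x → ¬ (x ∈ A × x ∈ B)

KGP : (r : ℕ) (N k n : ℕ) (p : Fin N → Fin n) → Hypergraph r
KGP r N k n p = record
  { V    = Σ (KSubset N k) (λ σ → ∀ i → ∣ proj₁ σ ∩ block p i ∣ ≤ 1)
  ; Edge = λ e → ∀ j j′ → j ≢ j′ → Disjoint (proj₁ (proj₁ (e j))) (proj₁ (proj₁ (e j′))) }

module Submission where

-- Send a vertex σ of KG^r(N,k;P) to the set
--   π(σ) = { i ∈ [n] | σ meets the block P_i }.
-- Since σ meets each block at most once, |π(σ)| = |σ| = k, so π(σ) is a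
-- vertex of KG^r_s(n,k).  If σ_1,…,σ_r are pairwise disjoint, then the
-- indices j with i ∈ π(σ_j) pick disjoint nonempty pieces σ_j ∩ P_i of
-- P_i, so i lies in at most |P_i| = s_i of the sets π(σ_j): π maps
-- hyperedges to hyperedges.  Composing a coloring of KG^r_s(n,k) with π
-- colors KG^r(N,k;P), whence χ(KG^r(N,k;P)) ≤ χ(KG^r_s(n,k)).

open import Defs
open import Data.Nat using (ℕ; _≤_; _∸_)
open import Data.Fin using (Fin)
open import Data.Fin.Subset using (∣_∣)
open import Data.Vec using (tabulate; sum)
open import Relation.Binary.PropositionalEquality using (_≡_)

open import Data.Nat using (zero; suc; _*_; z≤n; s≤s; _≤ᵇ_)
open import Data.Nat.Properties
  using (+-*-semiring; +-mono-≤; *-monoˡ-≤; *-identityˡ; *-identityʳ; *-comm;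
         ≤-reflexive; ≮⇒≥; module ≤-Reasoning)
open import Data.Fin using (_≟_)
open import Data.Fin.Properties using (suc-injective)
open import Data.Fin.Subset using (Subset; _∩_)
open import Data.Vec using ([]; _∷_; lookup)
open import Data.Vec.Properties using (lookup∘tabulate; lookup-zipWith; lookup⇒[]=)
open import Data.Bool using (Bool; true; false; _∧_)
open import Data.Product using (Σ; _,_; proj₁; proj₂)
open import Data.Empty using (⊥; ⊥-elim)
open import Function using (_∘_)
open import Relation.Nullary using (does)
open import Relation.Binary.PropositionalEquality
  using (refl; sym; trans; cong; _≢_; module ≡-Reasoning)
open import Algebra.Properties.Semiring.Sum +-*-semiring
  using (sum-syntax; sum-replicate-zero; sum-cong-≗; ∑-comm; *-distribˡ-sum)
  renaming (sum to ∑)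

Homomorphism : ∀ {r} → Hypergraph r → Hypergraph r → Set
Homomorphism H G = Σ (V H → V G) λ f → ∀ e → Edge H e → Edge G (f ∘ e)

pullback-colorable : ∀ {r m} {H G : Hypergraph r} →
  Homomorphism H G → Colorable G m → Colorable H m
pullback-colorable (f , f-edge) (c , c-ok) = c ∘ f , λ e e-edge → c-ok (f ∘ e) (f-edge e e-edge)

chromatic-≤ : ∀ {r a b} {H : Hypergraph r} →
  IsChromaticNumber H b → Colorable H a → b ≤ a
chromatic-≤ (_ , minimal) colorable = ≮⇒≥ λ a<b → minimal _ a<b colorable

chromatic-mono : ∀ {r a b} {H G : Hypergraph r} → Homomorphism H G →
  IsChromaticNumber G a → IsChromaticNumber H b → b ≤ a
chromatic-mono hom (G-colorable , _) χH = chromatic-≤ χH (pullback-colorable hom G-colorable)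

𝟙 : Bool → ℕ
𝟙 true  = 1
𝟙 false = 0

𝟙-∧ : ∀ a b → 𝟙 (a ∧ b) ≡ 𝟙 a * 𝟙 b
𝟙-∧ true  b = sym (*-identityˡ (𝟙 b))
𝟙-∧ false b = refl

∑-mono-≤ : ∀ {n} {f g : Fin n → ℕ} → (∀ i → f i ≤ g i) → ∑ f ≤ ∑ g
∑-mono-≤ {zero}  f≤g = z≤n
∑-mono-≤ {suc n} f≤g = +-mono-≤ (f≤g Fin.zero) (∑-mono-≤ (f≤g ∘ Fin.suc))

∑-δ : ∀ {n} (y : Fin n) → ∑[ i < n ] 𝟙 (does (y ≟ i)) ≡ 1
∑-δ {suc n} Fin.zero    = cong suc (sum-replicate-zero n)
∑-δ         (Fin.suc y) = ∑-δ y

∑-exclusive-≤1 : ∀ {r} (b : Fin r → Bool) →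
  (∀ j j′ → j ≢ j′ → b j ≡ true → b j′ ≡ true → ⊥) → ∑[ j < r ] 𝟙 (b j) ≤ 1
∑-exclusive-≤1 {zero}  b exclusive = z≤n
∑-exclusive-≤1 {suc r} b exclusive with b Fin.zero in b₀
... | true  = s≤s (≤-reflexive (∑-all-false (b ∘ Fin.suc) others-false))
  where
  ∑-all-false : ∀ {m} (c : Fin m → Bool) → (∀ j → c j ≡ false) → ∑[ j < m ] 𝟙 (c j) ≡ 0
  ∑-all-false {m} c all-false =
    trans (sum-cong-≗ (λ j → cong 𝟙 (all-false j))) (sum-replicate-zero m)
  others-false : ∀ j → b (Fin.suc j) ≡ false
  others-false j with b (Fin.suc j) in bⱼ
  ... | true  = ⊥-elim (exclusive Fin.zero (Fin.suc j) (λ ()) b₀ bⱼ)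
  ... | false = refl
... | false = ∑-exclusive-≤1 (b ∘ Fin.suc)
  λ j j′ j≢j′ → exclusive (Fin.suc j) (Fin.suc j′) (j≢j′ ∘ suc-injective)

∣∣-as-sum : ∀ {n} (A : Subset n) → ∣ A ∣ ≡ ∑[ x < n ] 𝟙 (lookup A x)
∣∣-as-sum []          = refl
∣∣-as-sum (true ∷ A)  = cong suc (∣∣-as-sum A)
∣∣-as-sum (false ∷ A) = ∣∣-as-sum A

∣∩∣-as-sum : ∀ {n} (A B : Subset n) →
  ∣ A ∩ B ∣ ≡ ∑[ x < n ] (𝟙 (lookup A x) * 𝟙 (lookup B x))
∣∩∣-as-sum A B = trans (∣∣-as-sum (A ∩ B)) (sum-cong-≗ λ x →
  trans (cong 𝟙 (lookup-zipWith _∧_ x A B)) (𝟙-∧ (lookup A x) (lookup B x)))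

module Projection {N n : ℕ} (p : Fin N → Fin n) where

  hits : Subset N → Fin n → ℕ
  hits σ i = ∣ σ ∩ block p i ∣

  hits-as-sum : ∀ σ i → hits σ i ≡ ∑[ x < N ] (𝟙 (lookup σ x) * 𝟙 (does (p x ≟ i)))
  hits-as-sum σ i = trans (∣∩∣-as-sum σ (block p i)) (sum-cong-≗ λ x →
    cong (λ b → 𝟙 (lookup σ x) * 𝟙 b) (lookup∘tabulate (λ y → does (p y ≟ i)) x))

  Transversal : Subset N → Set
  Transversal σ = ∀ i → hits σ i ≤ 1

  project : Subset N → Subset n
  project σ = tabulate λ i → 1 ≤ᵇ hits σ i

  𝟙-project : ∀ σ → Transversal σ → ∀ i → 𝟙 (lookup (project σ) i) ≡ hits σ i
  𝟙-project σ transversal i =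
    trans (cong 𝟙 (lookup∘tabulate (λ i → 1 ≤ᵇ hits σ i) i)) (𝟙-≤ᵇ (transversal i))
    where
    𝟙-≤ᵇ : ∀ {c} → c ≤ 1 → 𝟙 (1 ≤ᵇ c) ≡ c
    𝟙-≤ᵇ z≤n       = refl
    𝟙-≤ᵇ (s≤s z≤n) = refl

  ∣project∣ : ∀ σ → Transversal σ → ∣ project σ ∣ ≡ ∣ σ ∣
  ∣project∣ σ transversal = begin
    ∣ project σ ∣                                             ≡⟨ ∣∣-as-sum (project σ) ⟩
    ∑[ i < n ] 𝟙 (lookup (project σ) i)                       ≡⟨ sum-cong-≗ (𝟙-project σ transversal) ⟩
    ∑[ i < n ] hits σ i                                       ≡⟨ sum-cong-≗ (hits-as-sum σ) ⟩
    ∑[ i < n ] ∑[ x < N ] (𝟙 (lookup σ x) * 𝟙 (does (p x ≟ i))) ≡⟨ ∑-comm (λ i x → 𝟙 (lookup σ x) * 𝟙 (does (p x ≟ i))) ⟩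
    ∑[ x < N ] ∑[ i < n ] (𝟙 (lookup σ x) * 𝟙 (does (p x ≟ i))) ≡⟨ sum-cong-≗ in-one-block ⟩
    ∑[ x < N ] 𝟙 (lookup σ x)                                 ≡⟨ sym (∣∣-as-sum σ) ⟩
    ∣ σ ∣                                                     ∎
    where
    open ≡-Reasoning
    in-one-block : ∀ x → ∑[ i < n ] (𝟙 (lookup σ x) * 𝟙 (does (p x ≟ i))) ≡ 𝟙 (lookup σ x)
    in-one-block x = begin
      ∑[ i < n ] (𝟙 (lookup σ x) * 𝟙 (does (p x ≟ i))) ≡⟨ *-distribˡ-sum (𝟙 (lookup σ x)) (λ i → 𝟙 (does (p x ≟ i))) ⟨
      𝟙 (lookup σ x) * ∑[ i < n ] 𝟙 (does (p x ≟ i)) ≡⟨ cong (𝟙 (lookup σ x) *_) (∑-δ (p x)) ⟩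
      𝟙 (lookup σ x) * 1                             ≡⟨ *-identityʳ _ ⟩
      𝟙 (lookup σ x)                                 ∎

  PairwiseDisjoint : ∀ {r} → (Fin r → Subset N) → Set
  PairwiseDisjoint σ = ∀ j j′ → j ≢ j′ → Disjoint (σ j) (σ j′)

  -- Pairwise disjoint transversals σ_j project to sets covering i at most
  -- |P_i| times: Σ_j [i ∈ π(σ_j)] = Σ_j |σ_j ∩ P_i| = Σ_{x ∈ P_i} #{j | x ∈ σ_j}.
  project-multiplicity : ∀ {r} (σ : Fin r → Subset N) →
    (∀ j → Transversal (σ j)) → PairwiseDisjoint σ →
    ∀ i → ∑[ j < r ] 𝟙 (lookup (project (σ j)) i) ≤ ∣ block p i ∣
  project-multiplicity {r} σ transversal disjoint i = begin
    ∑[ j < r ] 𝟙 (lookup (project (σ j)) i)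
      ≡⟨ sum-cong-≗ (λ j → trans (𝟙-project (σ j) (transversal j) i) (hits-as-sum (σ j) i)) ⟩
    ∑[ j < r ] ∑[ x < N ] (𝟙 (lookup (σ j) x) * 𝟙 (in-block x))
      ≡⟨ ∑-comm (λ j x → 𝟙 (lookup (σ j) x) * 𝟙 (in-block x)) ⟩
    ∑[ x < N ] ∑[ j < r ] (𝟙 (lookup (σ j) x) * 𝟙 (in-block x))
      ≡⟨ sum-cong-≗ (λ x → ∑-*ʳ (𝟙 (in-block x)) (λ j → 𝟙 (lookup (σ j) x))) ⟨
    ∑[ x < N ] ((∑[ j < r ] 𝟙 (lookup (σ j) x)) * 𝟙 (in-block x))
      ≤⟨ ∑-mono-≤ (λ x → *-monoˡ-≤ (𝟙 (in-block x)) (at-most-one x)) ⟩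
    ∑[ x < N ] (1 * 𝟙 (in-block x))
      ≡⟨ sum-cong-≗ (λ x → trans (*-identityˡ _) (cong 𝟙 (sym (lookup∘tabulate in-block x)))) ⟩
    ∑[ x < N ] 𝟙 (lookup (block p i) x)
      ≡⟨ sym (∣∣-as-sum (block p i)) ⟩
    ∣ block p i ∣ ∎
    where
    open ≤-Reasoning
    in-block : Fin N → Bool
    in-block x = does (p x ≟ i)
    at-most-one : ∀ x → ∑[ j < r ] 𝟙 (lookup (σ j) x) ≤ 1
    at-most-one x = ∑-exclusive-≤1 (λ j → lookup (σ j) x) λ j j′ j≢j′ x∈σⱼ x∈σⱼ′ →
      disjoint j j′ j≢j′ x (lookup⇒[]= x (σ j) x∈σⱼ , lookup⇒[]= x (σ j′) x∈σⱼ′)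
    ∑-*ʳ : ∀ c (f : Fin r → ℕ) → ∑ f * c ≡ ∑[ j < r ] (f j * c)
    ∑-*ʳ c f = trans (*-comm (∑ f) c)
      (trans (*-distribˡ-sum c f) (sum-cong-≗ λ j → *-comm c (f j)))

  projection-homomorphism : ∀ r k (s : Fin n → ℕ) → (∀ i → ∣ block p i ∣ ≤ s i) →
    Homomorphism (KGP r N k n p) (KGs r n k s)
  projection-homomorphism r k s block≤s = π , π-edge
    where
    π : V (KGP r N k n p) → V (KGs r n k s)
    π ((σ , ∣σ∣≡k) , transversal) = project σ , trans (∣project∣ σ transversal) ∣σ∣≡k
    π-edge : ∀ e → Edge (KGP r N k n p) e → Edge (KGs r n k s) (π ∘ e)
    π-edge e disjoint i = begin
      mult (π ∘ e) i
        ≡⟨ ∣∣-as-sum (tabulate row) ⟩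
      ∑[ j < r ] 𝟙 (lookup (tabulate row) j)
        ≡⟨ sum-cong-≗ (cong 𝟙 ∘ lookup∘tabulate row) ⟩
      ∑[ j < r ] 𝟙 (row j)
        ≤⟨ project-multiplicity (λ j → proj₁ (proj₁ (e j))) (proj₂ ∘ e) disjoint i ⟩
      ∣ block p i ∣
        ≤⟨ block≤s i ⟩
      s i ∎
      where
      open ≤-Reasoning
      row : Fin r → Bool
      row j = lookup (proj₁ (π (e j))) i

lemma3p1 : (r k n : ℕ) → 2 ≤ r → 1 ≤ k → k ≤ n
    → (s : Fin n → ℕ) → (∀ i → 1 ≤ s i) → (∀ i → s i ≤ r ∸ 1)
    → (N : ℕ) → N ≡ sum (tabulate s)
    → (p : Fin N → Fin n) → (∀ i → ∣ block p i ∣ ≡ s i)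
    → (a b : ℕ) → IsChromaticNumber (KGs r n k s) a → IsChromaticNumber (KGP r N k n p) b
    → b ≤ a
lemma3p1 r k n _ _ _ s _ _ N _ p ∣Pᵢ∣≡sᵢ a b χ-KGs χ-KGP =
  chromatic-mono (projection-homomorphism r k s (≤-reflexive ∘ ∣Pᵢ∣≡sᵢ)) χ-KGs χ-KGP
  where open Projection p
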